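{- Let $v_1,\dots,v_n$ be distinct positive integers. Then there exist infinitely many positive integers $w$ such that, for all $i=1,\dots,n$, $v_iw+1$ is not a perfect square and the square-free part of $w$ is different from the square-free part of $v_i$.
   Context: The square-free part of a positive integer $v$ is the unique square-free positive integer $s$ such that $v=sm^2$ for some positive integer $m$. -}

module Defs where

open import Data.Nat using (ℕ; _*_; _<_)
open import Data.Nat.Divisibility using (_∣_)
open import Data.Product using (Σ; _×_; ∃)
open import Relation.Binary.PropositionalEquality using (_≡_)

IsSquare : ℕ → Set
IsSquare v = ∃ λ m → v ≡ m * m

SquareFree : ℕ → Set
SquareFree s = ∀ d → 1 < d → d * d ∣ s → Data.Empty.⊥
  where import Data.Empty

IsSquareFreePart : ℕ → ℕ → Set
IsSquareFreePart s v = (0 < s) × SquareFree s × (∃ λ m → (0 < m) × (v ≡ s * (m * m)))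

{-# OPTIONS --safe #-}
module Submission where

-- Take w to be a prime p larger than N and than every v_i + 2 (Euclid). Since p divides
-- v_i p exactly once, v_i p is not a square, so v_i and p cannot share a square-free part.
-- If v_i p + 1 = (d + 1)², then p divides d (d + 2), so p ≤ d + 2; hence v_i < d and
-- v_i p < d (d + 2), a contradiction.

open import Defs
open import Data.Nat using (ℕ; suc; _*_; _+_; _<_)
open import Data.Fin using (Fin)
open import Data.Product using (_×_; ∃)
open import Function.Definitions using (Injective)
open import Relation.Binary.PropositionalEquality using (_≡_; _≢_)
open import Relation.Nullary using (¬_)

open import Data.Nat using (zero; _≤_; _⊔_; _!; z≤n; s≤s; >-nonZero; >-nonZero⁻¹; nonTrivial⇒≢1)
open import Data.Nat.Properties
open import Data.Nat.Divisibility
open import Data.Nat.Primality using (Prime; euclidsLemma; prime⇒nonZero; prime⇒nonTrivial)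
open import Data.Nat.Primality.Factorisation using (factorise)
open import Data.Nat.ListAction using (product)
open import Data.Nat.Tactic.RingSolver using (solve-∀)
import Data.Fin as Fin
open import Data.List using ([]; _∷_)
open import Data.List.Relation.Unary.All using (_∷_)
open import Data.Product using (_,_)
open import Data.Sum using ([_,_]′; reduce)
open import Function using (_∘_)
open import Relation.Nullary using (contradiction)
open import Relation.Binary.PropositionalEquality using (refl; sym; trans; cong₂; subst)

finite-bounded : ∀ {n} (v : Fin n → ℕ) → ∃ λ B → ∀ i → v i ≤ B
finite-bounded {zero}  v = 0 , λ ()
finite-bounded {suc n} v with finite-bounded (v ∘ Fin.suc)
... | B , v∘suc≤B = v Fin.zero ⊔ B , λ
  { Fin.zero    → m≤m⊔n (v Fin.zero) B
  ; (Fin.suc i) → m≤n⇒m≤o⊔n (v Fin.zero) (v∘suc≤B i)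
  }

∃prime∣ : ∀ {n} → 1 < n → ∃ λ p → Prime p × p ∣ n
∃prime∣ {n} 1<n with factorise n {{>-nonZero (<-trans (s≤s z≤n) 1<n)}}
... | record { factors = [] ; isFactorisation = n≡1 } = contradiction n≡1 (>⇒≢ 1<n)
... | record { factors = p ∷ ps ; isFactorisation = n≡p*ps ; factorsPrime = prime[p] ∷ _ } =
  p , prime[p] , subst (p ∣_) (sym n≡p*ps) (m∣m*n (product ps))

m∣n! : ∀ {m n} → 0 < m → m ≤ n → m ∣ n !
m∣n! {suc m} _ m≤n = ∣-trans (m∣m*n (m !)) (m≤n⇒m!∣n! m≤n)

∃prime> : ∀ B → ∃ λ p → Prime p × B < p
∃prime> B with ∃prime∣ (s≤s (1≤n! B))
... | p , prime[p] , p∣1+B! = p , prime[p] , ≰⇒> p≰B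
  where
  p≰B : ¬ p ≤ B
  p≰B p≤B = nonTrivial⇒≢1 {{prime⇒nonTrivial prime[p]}}
    (∣1⇒≡1 (∣m+n∣m⇒∣n (subst (p ∣_) (+-comm 1 (B !)) p∣1+B!)
                       (m∣n! (>-nonZero⁻¹ p {{prime⇒nonZero prime[p]}}) p≤B)))

prime∣m*m⇒prime∣m : ∀ {p m} → Prime p → p ∣ m * m → p ∣ m
prime∣m*m⇒prime∣m {m = m} prime[p] p∣m*m = reduce (euclidsLemma m m prime[p] p∣m*m)

¬IsSquare[m*p] : ∀ {m p} → Prime p → 0 < m → m < p → ¬ IsSquare (m * p)
¬IsSquare[m*p] {m} {p} prime[p] 0<m m<p (c , m*p≡c*c) = <⇒≱ m<p (∣⇒≤ {{>-nonZero 0<m}} p∣m)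
  where
  p∣c : p ∣ c
  p∣c = prime∣m*m⇒prime∣m prime[p] (divides m (sym m*p≡c*c))
  p∣m : p ∣ m
  p∣m = *-cancelʳ-∣ p {{prime⇒nonZero prime[p]}}
          (subst (p * p ∣_) (sym m*p≡c*c) (*-pres-∣ p∣c p∣c))

¬IsSquare[m*p+1] : ∀ {m p} → Prime p → 0 < m → m + 2 < p → ¬ IsSquare (m * p + 1)
¬IsSquare[m*p+1] {m} {p} _ _ _ (zero , m*p+1≡0) = m+1+n≢0 (m * p) m*p+1≡0
¬IsSquare[m*p+1] {m} {p} prime[p] 0<m m+2<p (suc d , m*p+1≡[1+d]²) =
  <-irrefl (sym d*[d+2]≡m*p) (begin-strict
    m * p       <⟨ *-monoˡ-< p {{prime⇒nonZero prime[p]}} m<d ⟩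
    d * p       ≤⟨ *-monoʳ-≤ d p≤d+2 ⟩
    d * (d + 2) ∎)
  where
  open ≤-Reasoning
  [1+d]²≡1+d*[d+2] : ∀ d → suc d * suc d ≡ suc (d * (d + 2))
  [1+d]²≡1+d*[d+2] = solve-∀
  d*[d+2]≡m*p : d * (d + 2) ≡ m * p
  d*[d+2]≡m*p = sym (suc-injective
    (trans (trans (+-comm 1 (m * p)) m*p+1≡[1+d]²) ([1+d]²≡1+d*[d+2] d)))
  0<d : 0 < d
  0<d = n≢0⇒n>0 λ { refl →
    <⇒≢ 0<m (sym (m*n≡0⇒m≡0 m p {{prime⇒nonZero prime[p]}} (sym d*[d+2]≡m*p))) }
  p≤d+2 : p ≤ d + 2
  p≤d+2 = [ (λ p∣d → ≤-trans (∣⇒≤ {{>-nonZero 0<d}} p∣d) (m≤m+n d 2))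
          , ∣⇒≤ {{>-nonZero (≤-trans (s≤s z≤n) (m≤n+m 2 d))}} ]′
          (euclidsLemma d (d + 2) prime[p] (divides m d*[d+2]≡m*p))
  m<d : m < d
  m<d = +-cancelʳ-< 2 m d (<-≤-trans m+2<p p≤d+2)

IsSquareFreePart⇒IsSquare[*] : ∀ {s x y} → IsSquareFreePart s x → IsSquareFreePart s y →
                               IsSquare (x * y)
IsSquareFreePart⇒IsSquare[*] {s} (_ , _ , a , _ , x≡s*a²) (_ , _ , b , _ , y≡s*b²) =
  s * a * b , trans (cong₂ _*_ x≡s*a² y≡s*b²) (s*a²*[s*b²]≡[s*a*b]² s a b)
  where
  s*a²*[s*b²]≡[s*a*b]² : ∀ s a b → s * (a * a) * (s * (b * b)) ≡ s * a * b * (s * a * b)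
  s*a²*[s*b²]≡[s*a*b]² = solve-∀

lemma1 : (n : ℕ) (v : Fin n → ℕ) → Injective _≡_ _≡_ v → (∀ i → 0 < v i) →
             ∀ N → ∃ λ w → (N < w) × (∀ i → ¬ IsSquare (v i * w + 1)
               × (∀ s t → IsSquareFreePart s w → IsSquareFreePart t (v i) → s ≢ t))
lemma1 n v _ 0<v N with finite-bounded (λ i → v i + 2)
... | B , v+2≤B with ∃prime> (N ⊔ B)
... | p , prime[p] , N⊔B<p = p , N<p , λ i →
  ¬IsSquare[m*p+1] prime[p] (0<v i) (v+2<p i) ,
  λ s t sfp[p] sfp[v] s≡t →
    ¬IsSquare[m*p] prime[p] (0<v i) (≤-<-trans (m≤m+n (v i) 2) (v+2<p i))
      (IsSquareFreePart⇒IsSquare[*] sfp[v] (subst (λ u → IsSquareFreePart u p) s≡t sfp[p]))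
  where
  N<p : N < p
  N<p = m⊔n<o⇒m<o N B N⊔B<p
  v+2<p : ∀ i → v i + 2 < p
  v+2<p i = ≤-<-trans (v+2≤B i) (m⊔n<o⇒n<o N B N⊔B<p)
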